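{- Let $G$ be a finite graph and let $X_\gamma(G)$ denote the number of $\gamma$-sets of $G$. If $X_\gamma(G)<2^{\gamma(G)-1}$, then $\gamma_{\rm MB}(G)>\gamma(G)$.
   Context: All graphs are finite and simple. $\gamma(G)$ is the domination number; a $\gamma$-set is a dominating set of size $\gamma(G)$. The Maker-Breaker domination game on $G$: Dominator and Staller alternately select a vertex not selected before; Dominator wins if at some point his selected vertices form a dominating set of $G$, Staller wins otherwise. In the D-game Dominator moves first. $\gamma_{\rm MB}(G)$ is the minimum $k$ such that Dominator has a strategy in the D-game guaranteeing that his selected vertices dominate $G$ after at most $k$ of his moves, whatever Staller does ($\gamma_{\rm MB}(G)=\infty$ if he has no winning strategy, with $\infty$ larger than every integer). -}

module Defs where

open import Data.Nat using (ℕ; zero; suc; _<_; _≤_; _^_; _∸_)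
open import Data.Bool using (Bool; true; false; _≟_)
open import Data.Fin using (Fin)
open import Data.Fin.Properties using (any?; all?)
open import Data.Fin.Subset using (Subset; _∈_; _∉_; _∪_; ⁅_⁆; ∣_∣; ⊥; inside; outside)
open import Data.Fin.Subset.Properties using (_∈?_)
open import Data.Vec using (Vec; []; _∷_)
open import Data.List using (List; []; _∷_; _++_; map; filter; length)
open import Data.Product using (Σ; ∃; ∃-syntax; _×_; _,_)
open import Data.Sum using (_⊎_)
open import Relation.Nullary using (Dec; ¬_)
open import Relation.Nullary.Decidable using (_⊎-dec_; _×-dec_)
open import Relation.Binary.PropositionalEquality using (_≡_)
import Data.Nat as ℕ

record Graph (n : ℕ) : Set where
  field
    adj   : Fin n → Fin n → Bool
    sym   : ∀ u v → adj u v ≡ adj v u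
    irrefl : ∀ v → adj v v ≡ false
open Graph public

Dominating : ∀ {n} → Graph n → Subset n → Set
Dominating G D = ∀ v → v ∈ D ⊎ (∃[ u ] (u ∈ D × adj G u v ≡ true))

dominating? : ∀ {n} (G : Graph n) (D : Subset n) → Dec (Dominating G D)
dominating? G D = all? (λ v → (v ∈? D) ⊎-dec any? (λ u → (u ∈? D) ×-dec (adj G u v ≟ true)))

IsDominationNumber : ∀ {n} → Graph n → ℕ → Set
IsDominationNumber {n} G g =
  (Σ (Subset n) λ D → Dominating G D × ∣ D ∣ ≡ g)
  × (∀ (D : Subset n) → Dominating G D → g ≤ ∣ D ∣)

allSubsets : (n : ℕ) → List (Subset n)
allSubsets zero = [] ∷ []
allSubsets (suc n) = map (inside ∷_) (allSubsets n) ++ map (outside ∷_) (allSubsets n)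

numDomSetsOfSize : ∀ {n} → Graph n → ℕ → ℕ
numDomSetsOfSize {n} G g =
  length (filter (λ D → dominating? G D ×-dec (∣ D ∣ ℕ.≟ g)) (allSubsets n))

-- Maker–Breaker domination game.  A position is (D , S): the vertices
-- selected so far by Dominator and by Staller.  A vertex is free if
-- selected by neither.
Free : ∀ {n} → Subset n → Subset n → Fin n → Set
Free D S v = v ∉ D × v ∉ S

-- DomWins G k D S : in position (D , S) with Dominator to move,
-- Dominator has a strategy ensuring that his selected vertices dominate G
-- after at most k further moves of his, whatever Staller does.
-- The game ends (Staller wins) when all vertices are selected and
-- Dominator's set is not dominating.
data DomWins {n} (G : Graph n) : ℕ → Subset n → Subset n → Set where
  done : ∀ {k D S} → Dominating G D → DomWins G k D S
  move : ∀ {k D S} (v : Fin n) → Free D S v →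
         -- the game is not over after Dominator's move: Staller has a move
         (∃[ u ] Free (D ∪ ⁅ v ⁆) S u) →
         (∀ u → Free (D ∪ ⁅ v ⁆) S u → DomWins G k (D ∪ ⁅ v ⁆) (S ∪ ⁅ u ⁆)) →
         DomWins G (suc k) D S
  final : ∀ {k D S} (v : Fin n) → Free D S v → Dominating G (D ∪ ⁅ v ⁆) →
          DomWins G (suc k) D S

-- In the D-game (Dominator starts, nothing selected) Dominator can
-- guarantee domination within at most k of his moves.
-- γ_MB(G) is the least such k (∞ if none).
MBWithin : ∀ {n} → Graph n → ℕ → Set
MBWithin G k = DomWins G k ⊥ ⊥

-- Erdős–Selfridge potential argument.  Weight each γ-set T not yet touched
-- by Staller with 2^|T ∩ D|, D being Dominator's vertices.  A vertex claimed
-- by Dominator adds to the potential the weight of the live γ-sets through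
-- it; Staller, answering with the vertex of largest such weight, removes at
-- least as much as Dominator's next move can add.  If Dominator dominated
-- within k ≤ γ moves his set would be a live γ-set of weight 2^γ, so the
-- potential could be raised to 2^γ, whereas at the start it is the number
-- X of γ-sets and one move at most doubles it: 2^γ ≤ 2X.
module Submission where

open import Defs hiding (sym)
open import Algebra.Properties.CommutativeSemigroup using (interchange)
open import Data.Bool using (true; false; if_then_else_)
open import Data.Fin using (Fin; zero; suc)
open import Data.Fin.Subset
  using (Subset; _∉_; _∪_; _∩_; ⁅_⁆; ∣_∣; ⊤; ⊥; inside; outside)
open import Data.Fin.Subset.Properties
  using (_∈?_; ∈⊤; ∣⊥∣≡0; p⊆p∪q; drop-not-there; ∩-comm; ∩-idem; ∩-zeroʳ; ∩-identityˡ; ∪-identityʳ)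
open import Data.List using (List; []; _∷_; map; filter; length; allFin)
open import Data.List.Properties using (map-cong)
open import Data.List.Extrema.Nat using (argmax; argmax-all; f[xs]≤f[argmax])
open import Data.List.Membership.Propositional using () renaming (_∈_ to _∈ₗ_)
open import Data.List.Membership.Propositional.Properties
  using (∈-++⁺ˡ; ∈-++⁺ʳ; ∈-map⁺; ∈-filter⁺; ∈-allFin)
import Data.List.Relation.Unary.All as All
open import Data.List.Relation.Unary.All.Properties using (all-filter)
open import Data.List.Relation.Unary.Any using (here; there)
open import Data.Nat using (ℕ; zero; suc; _+_; _*_; _≤_; _<_; _^_; _∸_; _≡ᵇ_; z≤n; s≤s; _<?_)
import Data.Nat as ℕ
open import Data.Nat.ListAction using (sum)
open import Data.Nat.Properties
open import Data.Product using (∃-syntax; _×_; _,_; proj₁; proj₂)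
open import Data.Sum using (_⊎_; inj₁; inj₂)
open import Data.Vec using ([]; _∷_; lookup)
import Data.Vec as Vec
open import Data.Vec.Properties using (lookup⇒[]=; []=⇒lookup)
open import Function using (_∘_)
open import Relation.Nullary using (yes; no; ¬?; contradiction)
open import Relation.Nullary.Decidable using (_×-dec_)
open import Relation.Unary using (Decidable)
open import Relation.Binary.PropositionalEquality

∉⇒lookup≡false : ∀ {n} {D : Subset n} {v : Fin n} → v ∉ D → lookup D v ≡ false
∉⇒lookup≡false {D = D} {v} v∉D with lookup D v in eq
... | true  = contradiction (lookup⇒[]= v D eq) v∉D
... | false = refl

∣∩∪⁅⁆∣ : ∀ {n} (T D : Subset n) {v : Fin n} → v ∉ D →
         ∣ T ∩ (D ∪ ⁅ v ⁆) ∣ ≡ (if lookup T v then suc ∣ T ∩ D ∣ else ∣ T ∩ D ∣)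
∣∩∪⁅⁆∣ (true  ∷ T) (false ∷ D) {zero}  _   rewrite ∪-identityʳ D = refl
∣∩∪⁅⁆∣ (false ∷ T) (false ∷ D) {zero}  _   rewrite ∪-identityʳ D = refl
∣∩∪⁅⁆∣ (_     ∷ T) (true  ∷ D) {zero}  v∉D = contradiction Vec.here v∉D
∣∩∪⁅⁆∣ (t ∷ T) (d ∷ D) {suc v} v∉D with lookup T v | ∣∩∪⁅⁆∣ T D (drop-not-there v∉D)
∣∩∪⁅⁆∣ (true  ∷ T) (true  ∷ D) {suc v} v∉D | true  | eq = cong suc eq
∣∩∪⁅⁆∣ (true  ∷ T) (true  ∷ D) {suc v} v∉D | false | eq = cong suc eq
∣∩∪⁅⁆∣ (true  ∷ T) (false ∷ D) {suc v} v∉D | _     | eq = eq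
∣∩∪⁅⁆∣ (false ∷ T) (d     ∷ D) {suc v} v∉D | _     | eq = eq

∣∩∪⁅⁆∣-∉ : ∀ {n} (T D : Subset n) {v : Fin n} → v ∉ T → v ∉ D →
           ∣ T ∩ (D ∪ ⁅ v ⁆) ∣ ≡ ∣ T ∩ D ∣
∣∩∪⁅⁆∣-∉ T D v∉T v∉D rewrite ∣∩∪⁅⁆∣ T D v∉D | ∉⇒lookup≡false v∉T = refl

∣∪⁅⁆∣ : ∀ {n} (D : Subset n) {v : Fin n} → v ∉ D → ∣ D ∪ ⁅ v ⁆ ∣ ≡ suc ∣ D ∣
∣∪⁅⁆∣ D {v} v∉D = begin
  ∣ D ∪ ⁅ v ⁆ ∣      ≡⟨ cong ∣_∣ (∩-identityˡ (D ∪ ⁅ v ⁆)) ⟨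
  ∣ ⊤ ∩ (D ∪ ⁅ v ⁆) ∣ ≡⟨ ∣∩∪⁅⁆∣ ⊤ D v∉D ⟩
  (if lookup ⊤ v then suc ∣ ⊤ ∩ D ∣ else ∣ ⊤ ∩ D ∣)
                      ≡⟨ cong (λ b → if b then suc ∣ ⊤ ∩ D ∣ else ∣ ⊤ ∩ D ∣) ([]=⇒lookup (∈⊤ {x = v})) ⟩
  suc ∣ ⊤ ∩ D ∣      ≡⟨ cong (suc ∘ ∣_∣) (∩-identityˡ D) ⟩
  suc ∣ D ∣          ∎
  where open ≡-Reasoning

∈-allSubsets : ∀ {n} (T : Subset n) → T ∈ₗ allSubsets n
∈-allSubsets []                = here refl
∈-allSubsets {suc n} (true ∷ T)  = ∈-++⁺ˡ (∈-map⁺ (inside ∷_) (∈-allSubsets T))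
∈-allSubsets {suc n} (false ∷ T) =
  ∈-++⁺ʳ (map (inside ∷_) (allSubsets n)) (∈-map⁺ (outside ∷_) (∈-allSubsets T))

module _ {A : Set} where

  sum-map-+ : ∀ (f h : A → ℕ) xs →
              sum (map (λ x → f x + h x) xs) ≡ sum (map f xs) + sum (map h xs)
  sum-map-+ f h []       = refl
  sum-map-+ f h (x ∷ xs) = trans (cong (f x + h x +_) (sum-map-+ f h xs))
                                 (interchange +-commutativeSemigroup (f x) (h x) _ _)

  sum-map-mono : ∀ {f h : A → ℕ} → (∀ x → f x ≤ h x) → ∀ xs → sum (map f xs) ≤ sum (map h xs)
  sum-map-mono f≤h []       = z≤n
  sum-map-mono f≤h (x ∷ xs) = +-mono-≤ (f≤h x) (sum-map-mono f≤h xs)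

  ∈⇒≤sum-map : ∀ (f : A → ℕ) {x xs} → x ∈ₗ xs → f x ≤ sum (map f xs)
  ∈⇒≤sum-map f {xs = y ∷ ys} (here refl) = m≤m+n (f y) _
  ∈⇒≤sum-map f {xs = y ∷ ys} (there x∈ys) = ≤-trans (∈⇒≤sum-map f x∈ys) (m≤n+m _ (f y))

  sum-map-1 : ∀ {f : A → ℕ} → (∀ x → f x ≡ 1) → ∀ xs → sum (map f xs) ≡ length xs
  sum-map-1 f≡1 []       = refl
  sum-map-1 f≡1 (x ∷ xs) = cong₂ _+_ (f≡1 x) (sum-map-1 f≡1 xs)

module Potential {n : ℕ} (F : List (Subset n)) where

  weight : Subset n → Subset n → Subset n → ℕ
  weight D S T = if ∣ T ∩ S ∣ ≡ᵇ 0 then 2 ^ ∣ T ∩ D ∣ else 0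

  weightThrough : Subset n → Subset n → Fin n → Subset n → ℕ
  weightThrough D S x T = if lookup T x then weight D S T else 0

  potential : Subset n → Subset n → ℕ
  potential D S = sum (map (weight D S) F)

  potentialThrough : Subset n → Subset n → Fin n → ℕ
  potentialThrough D S x = sum (map (weightThrough D S x) F)

  weight-claimByStaller : ∀ D S {u} T → u ∉ S →
                          weight D (S ∪ ⁅ u ⁆) T + weightThrough D S u T ≡ weight D S T
  weight-claimByStaller D S {u} T u∉S rewrite ∣∩∪⁅⁆∣ T S u∉S with lookup T u
  ... | true  = refl
  ... | false = +-identityʳ _

  weight-claimByDominator : ∀ D S {v} T → v ∉ D →
                            weight (D ∪ ⁅ v ⁆) S T ≡ weight D S T + weightThrough D S v T
  weight-claimByDominator D S {v} T v∉D rewrite ∣∩∪⁅⁆∣ T D v∉D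
    with lookup T v | ∣ T ∩ S ∣ ≡ᵇ 0
  ... | true  | true  = cong (2 ^ ∣ T ∩ D ∣ +_) (+-identityʳ _)
  ... | true  | false = refl
  ... | false | true  = sym (+-identityʳ _)
  ... | false | false = refl

  weight-antitone : ∀ D S {u} T → u ∉ S → weight D (S ∪ ⁅ u ⁆) T ≤ weight D S T
  weight-antitone D S {u} T u∉S =
    subst (weight D (S ∪ ⁅ u ⁆) T ≤_) (weight-claimByStaller D S T u∉S) (m≤m+n _ _)

  weightThrough-antitone : ∀ D S {u} x T → u ∉ S →
                           weightThrough D (S ∪ ⁅ u ⁆) x T ≤ weightThrough D S x T
  weightThrough-antitone D S x T u∉S with lookup T x
  ... | true  = weight-antitone D S T u∉S
  ... | false = z≤n

  weightThrough≤weight : ∀ D S x T → weightThrough D S x T ≤ weight D S T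
  weightThrough≤weight D S x T with lookup T x
  ... | true  = ≤-refl
  ... | false = z≤n

  weight≤potential : ∀ D S {T} → T ∈ₗ F → weight D S T ≤ potential D S
  weight≤potential D S = ∈⇒≤sum-map (weight D S)

  potential-⊥-⊥ : potential ⊥ ⊥ ≡ length F
  potential-⊥-⊥ = sum-map-1 weight-⊥-⊥ F
    where
    weight-⊥-⊥ : ∀ T → weight ⊥ ⊥ T ≡ 1
    weight-⊥-⊥ T rewrite ∩-zeroʳ T | ∣⊥∣≡0 n = refl

  potential-claimByStaller : ∀ D S {u} → u ∉ S →
                             potential D (S ∪ ⁅ u ⁆) + potentialThrough D S u ≡ potential D S
  potential-claimByStaller D S u∉S =
    trans (sym (sum-map-+ _ _ F)) (cong sum (map-cong (λ T → weight-claimByStaller D S T u∉S) F))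

  potential-claimByDominator : ∀ D S {v} → v ∉ D →
                               potential (D ∪ ⁅ v ⁆) S ≡ potential D S + potentialThrough D S v
  potential-claimByDominator D S v∉D =
    trans (cong sum (map-cong (λ T → weight-claimByDominator D S T v∉D) F)) (sum-map-+ _ _ F)

  potential-antitone : ∀ D S {u} → u ∉ S → potential D (S ∪ ⁅ u ⁆) ≤ potential D S
  potential-antitone D S u∉S = sum-map-mono (λ T → weight-antitone D S T u∉S) F

  potentialThrough-antitone : ∀ D S {u} x → u ∉ S →
                              potentialThrough D (S ∪ ⁅ u ⁆) x ≤ potentialThrough D S x
  potentialThrough-antitone D S x u∉S = sum-map-mono (λ T → weightThrough-antitone D S x T u∉S) F

  potential-claimByDominator-≤ : ∀ D S {v} → v ∉ D → potential (D ∪ ⁅ v ⁆) S ≤ 2 * potential D S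
  potential-claimByDominator-≤ D S {v} v∉D = begin
    potential (D ∪ ⁅ v ⁆) S                ≡⟨ potential-claimByDominator D S v∉D ⟩
    potential D S + potentialThrough D S v ≤⟨ +-monoʳ-≤ (potential D S) through≤ ⟩
    potential D S + potential D S          ≡⟨ cong (potential D S +_) (+-identityʳ _) ⟨
    2 * potential D S                      ∎
    where
    open ≤-Reasoning
    through≤ : potentialThrough D S v ≤ potential D S
    through≤ = sum-map-mono (weightThrough≤weight D S v) F

  Free? : (D S : Subset n) → Decidable (Free D S)
  Free? D S x = ¬? (x ∈? D) ×-dec ¬? (x ∈? S)

  bestReply : Subset n → Subset n → Fin n → Fin n
  bestReply D S u₀ = argmax (potentialThrough D S) u₀ (filter (Free? D S) (allFin n))

  bestReply-free : ∀ {D S u₀} → Free D S u₀ → Free D S (bestReply D S u₀)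
  bestReply-free {D} {S} free₀ =
    argmax-all (potentialThrough D S) free₀ (all-filter (Free? D S) (allFin n))

  bestReply-maximal : ∀ {D S} u₀ {x} → Free D S x →
                      potentialThrough D S x ≤ potentialThrough D S (bestReply D S u₀)
  bestReply-maximal {D} {S} u₀ {x} free =
    All.lookup (f[xs]≤f[argmax] u₀ (filter (Free? D S) (allFin n)))
               (∈-filter⁺ (Free? D S) (∈-allFin x) free)

  bestReply-blocks : ∀ {D S u₀} → Free D S u₀ → let u = bestReply D S u₀ in
                     ∀ {x} → Free D (S ∪ ⁅ u ⁆) x → potential (D ∪ ⁅ x ⁆) (S ∪ ⁅ u ⁆) ≤ potential D S
  bestReply-blocks {D} {S} {u₀} free₀ {x} (x∉D , x∉S∪u) = begin
    potential (D ∪ ⁅ x ⁆) (S ∪ ⁅ u ⁆)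
      ≡⟨ potential-claimByDominator D (S ∪ ⁅ u ⁆) x∉D ⟩
    potential D (S ∪ ⁅ u ⁆) + potentialThrough D (S ∪ ⁅ u ⁆) x
      ≤⟨ +-monoʳ-≤ _ (potentialThrough-antitone D S x u∉S) ⟩
    potential D (S ∪ ⁅ u ⁆) + potentialThrough D S x
      ≤⟨ +-monoʳ-≤ _ (bestReply-maximal u₀ (x∉D , x∉S∪u ∘ p⊆p∪q ⁅ u ⁆)) ⟩
    potential D (S ∪ ⁅ u ⁆) + potentialThrough D S u
      ≡⟨ potential-claimByStaller D S u∉S ⟩
    potential D S
      ∎
    where
    open ≤-Reasoning
    u = bestReply D S u₀
    u∉S = proj₂ (bestReply-free free₀)

module DGame {n : ℕ} (G : Graph n) (g : ℕ) (γ : IsDominationNumber G g) where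

  γSets : List (Subset n)
  γSets = filter (λ D → dominating? G D ×-dec (∣ D ∣ ℕ.≟ g)) (allSubsets n)

  open Potential γSets

  HighPotential : Subset n → Subset n → Set
  HighPotential D S = 2 ^ g ≤ potential D S ⊎ ∃[ v ] Free D S v × 2 ^ g ≤ potential (D ∪ ⁅ v ⁆) S

  dominating⇒2^g≤potential : ∀ {D S : Subset n} → Dominating G D → ∣ D ∩ S ∣ ≡ 0 → ∣ D ∣ ≤ g →
                             2 ^ g ≤ potential D S
  dominating⇒2^g≤potential {D} {S} dom D∩S≡0 ∣D∣≤g =
    ≤-trans (≤-reflexive (sym weight≡2^g))
            (weight≤potential D S (∈-filter⁺ _ (∈-allSubsets D) (dom , ∣D∣≡g)))
    where
    ∣D∣≡g : ∣ D ∣ ≡ g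
    ∣D∣≡g = ≤-antisym ∣D∣≤g (proj₂ γ D dom)
    weight≡2^g : weight D S D ≡ 2 ^ g
    weight≡2^g rewrite D∩S≡0 | ∩-idem D | ∣D∣≡g = refl

  ∣∪⁅⁆∩∣≡0 : ∀ {D S : Subset n} {v} → Free D S v → ∣ D ∩ S ∣ ≡ 0 → ∣ (D ∪ ⁅ v ⁆) ∩ S ∣ ≡ 0
  ∣∪⁅⁆∩∣≡0 {D} {S} {v} (v∉D , v∉S) D∩S≡0 = begin
    ∣ (D ∪ ⁅ v ⁆) ∩ S ∣ ≡⟨ cong ∣_∣ (∩-comm (D ∪ ⁅ v ⁆) S) ⟩
    ∣ S ∩ (D ∪ ⁅ v ⁆) ∣ ≡⟨ ∣∩∪⁅⁆∣-∉ S D v∉S v∉D ⟩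
    ∣ S ∩ D ∣           ≡⟨ cong ∣_∣ (∩-comm S D) ⟩
    ∣ D ∩ S ∣           ≡⟨ D∩S≡0 ⟩
    0                   ∎
    where open ≡-Reasoning

  ∣∪⁅⁆∣+k≤g : ∀ {D : Subset n} {v k} → v ∉ D → ∣ D ∣ + suc k ≤ g → ∣ D ∪ ⁅ v ⁆ ∣ + k ≤ g
  ∣∪⁅⁆∣+k≤g {D} {v} {k} v∉D =
    subst (_≤ g) (trans (+-suc ∣ D ∣ k) (cong (_+ k) (sym (∣∪⁅⁆∣ D v∉D))))

  win⇒highPotential : ∀ {k} {D S : Subset n} → DomWins G k D S → ∣ D ∩ S ∣ ≡ 0 → ∣ D ∣ + k ≤ g →
                      HighPotential D S
  win⇒highPotential (done dom) D∩S≡0 ∣D∣+k≤g =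
    inj₁ (dominating⇒2^g≤potential dom D∩S≡0 (m+n≤o⇒m≤o _ ∣D∣+k≤g))
  win⇒highPotential (final v free dom) D∩S≡0 ∣D∣+k≤g =
    inj₂ (v , free , dominating⇒2^g≤potential dom (∣∪⁅⁆∩∣≡0 free D∩S≡0)
                       (m+n≤o⇒m≤o _ (∣∪⁅⁆∣+k≤g (proj₁ free) ∣D∣+k≤g)))
  win⇒highPotential {D = D} {S} (move v free (u₀ , free₀) next) D∩S≡0 ∣D∣+k≤g
    with win⇒highPotential (next u free-u) D'∩S'≡0 (∣∪⁅⁆∣+k≤g (proj₁ free) ∣D∣+k≤g)
    where
    u = bestReply (D ∪ ⁅ v ⁆) S u₀
    free-u = bestReply-free free₀
    D'∩S'≡0 : ∣ (D ∪ ⁅ v ⁆) ∩ (S ∪ ⁅ u ⁆) ∣ ≡ 0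
    D'∩S'≡0 = trans (∣∩∪⁅⁆∣-∉ (D ∪ ⁅ v ⁆) S (proj₁ free-u) (proj₂ free-u))
                    (∣∪⁅⁆∩∣≡0 free D∩S≡0)
  ... | inj₁ 2^g≤ = inj₂ (v , free , ≤-trans 2^g≤ (potential-antitone _ S (proj₂ (bestReply-free free₀))))
  ... | inj₂ (x , free-x , 2^g≤) = inj₂ (v , free , ≤-trans 2^g≤ (bestReply-blocks free₀ free-x))

  highPotential⇒2^g≤2*potential : ∀ {D S : Subset n} → HighPotential D S → 2 ^ g ≤ 2 * potential D S
  highPotential⇒2^g≤2*potential {D} {S} (inj₁ 2^g≤) = ≤-trans 2^g≤ (m≤m+n (potential D S) _)
  highPotential⇒2^g≤2*potential {D} {S} (inj₂ (v , (v∉D , _) , 2^g≤)) =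
    ≤-trans 2^g≤ (potential-claimByDominator-≤ D S v∉D)

  fastWin⇒2^g≤2*#γSets : ∀ {k} → MBWithin G k → k ≤ g → 2 ^ g ≤ 2 * numDomSetsOfSize G g
  fastWin⇒2^g≤2*#γSets {k} win k≤g =
    subst (λ p → 2 ^ g ≤ 2 * p) potential-⊥-⊥ (highPotential⇒2^g≤2*potential
      (win⇒highPotential win ⊥∩⊥≡0 (subst (λ c → c + k ≤ g) (sym (∣⊥∣≡0 n)) k≤g)))
    where
    ⊥∩⊥≡0 : ∣ ⊥ {n = n} ∩ ⊥ ∣ ≡ 0
    ⊥∩⊥≡0 = trans (cong ∣_∣ (∩-zeroʳ (⊥ {n = n}))) (∣⊥∣≡0 n)

2^g≤2*x⇒2^[g∸1]≤x : ∀ g x → 2 ^ g ≤ 2 * x → 2 ^ (g ∸ 1) ≤ x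
2^g≤2*x⇒2^[g∸1]≤x zero    zero    ()
2^g≤2*x⇒2^[g∸1]≤x zero    (suc x) _ = s≤s z≤n
2^g≤2*x⇒2^[g∸1]≤x (suc g) x       h = *-cancelˡ-≤ 2 h

proposition3p3 : (n : ℕ) (G : Graph n) (g : ℕ) →
    IsDominationNumber G g →
    numDomSetsOfSize G g < 2 ^ (g ∸ 1) →
    ∀ (k : ℕ) → MBWithin G k → g < k
proposition3p3 n G g γ few k win with g <? k
... | yes g<k = g<k
... | no  g≮k = contradiction (2^g≤2*x⇒2^[g∸1]≤x g _ (fastWin⇒2^g≤2*#γSets win (≮⇒≥ g≮k))) (<⇒≱ few)
  where open DGame G g γ
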